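{- Let $p\in(0,1)$. For $n\ge 1$, consider the transitive tournament on vertex set $\{1,\dots,n\}$ with directed edges $(i,j)$ for all $1\le i<j\le n$, whose edges carry independent $\mathcal{B}(p)$ random weights, and let $X_n$ be the maximum weight of a directed path from $1$ to $n$. Let $t$ be a formal indeterminate and $Y_n=t^{X_n}$. Then for every $n\ge1$, \[ \mathbb{E}[Y_n]=\sum_{i=1}^{n-1} t\Big[(1-p)^{\binom{i}{2}}-(1-p)^{\binom{i+1}{2}}\Big]\,\mathbb{E}[Y_{n-i}] + (1-p)^{\binom{n}{2}}. \] Consequently, with the convention $\mathbb{E}[Y_0]=1$ and $Z(x,t)=\sum_{n\ge0}\mathbb{E}[Y_n]x^n$, \[ Z(x,t)=1+\frac{xB_p(x)}{1-t\,[A_p(x)-B_p(x)]}, \] where $A_p(x)=\sum_{n\ge0}(1-p)^{\binom n2}x^n$ and $B_p(x)=\sum_{n\ge0}(1-p)^{\binom{n+1}{2}}x^n$.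
   Context: $\mathcal{B}(p)$ denotes the Bernoulli distribution taking value $1$ with probability $p$ and $0$ with probability $1-p$. The weight of a directed path is the sum of its edge weights; $X_1=0$. $\mathbb{E}[Y_n]$ is the probability generating function of $X_n$, a polynomial in $t$. -}

module Defs where

open import Level using (_⊔_)
open import Algebra.Bundles using (CommutativeRing)
open import Data.Nat using (ℕ; zero; suc; _∸_; _≡ᵇ_; _≤_)
  renaming (_⊔_ to max; _+_ to _+ℕ_)
open import Data.Nat.Combinatorics using (_C_)
open import Data.Bool using (Bool; true; false; if_then_else_; _∧_)
open import Data.List using (List; []; _∷_; _++_; map; foldr; length; concatMap; zip)
open import Data.Product using (_×_; _,_)

allBools : ℕ → List (List Bool)
allBools zero = [] ∷ []
allBools (suc k) = concatMap (λ bs → (true ∷ bs) ∷ (false ∷ bs) ∷ []) (allBools k)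

range : ℕ → ℕ → List ℕ
range a zero = []
range a (suc k) = a ∷ range (suc a) k

edges : ℕ → List (ℕ × ℕ)
edges n = concatMap (λ i → map (λ j → (i , j)) (range (suc i) (n ∸ i))) (range 1 n)

-- A configuration: each edge together with its Bernoulli value (true = weight 1).
Config : Set
Config = List ((ℕ × ℕ) × Bool)

configs : ℕ → List Config
configs n = map (zip (edges n)) (allBools (length (edges n)))

edgeWeight : Config → ℕ → ℕ → ℕ
edgeWeight c i j =
  foldr (λ { ((i′ , j′) , b) rest →
              if (i ≡ᵇ i′) ∧ (j ≡ᵇ j′) then (if b then 1 else 0) else rest })
        0 c

subsets : List ℕ → List (List ℕ)
subsets [] = [] ∷ []
subsets (x ∷ xs) = map (x ∷_) (subsets xs) ++ subsets xs

-- All directed paths from 1 to n (as vertex lists 1 = v₀ < v₁ < … < v_k = n).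
-- Since every i<j is an edge, these are exactly 1 ∷ S ++ [n] for S ⊆ {2,…,n-1}.
paths : ℕ → List (List ℕ)
paths zero = []
paths (suc zero) = (1 ∷ []) ∷ []
paths (suc (suc m)) = map (λ S → 1 ∷ (S ++ (suc (suc m) ∷ []))) (subsets (range 2 m))

pathWeight : Config → List ℕ → ℕ
pathWeight c (v ∷ w ∷ vs) = edgeWeight c v w +ℕ pathWeight c (w ∷ vs)
pathWeight c _ = 0

X : ℕ → Config → ℕ
X n c = foldr max 0 (map (pathWeight c) (paths n))

module Model {c ℓ} (R : CommutativeRing c ℓ) where
  open CommutativeRing R

  pow : Carrier → ℕ → Carrier
  pow x zero = 1#
  pow x (suc k) = x * pow x k

  sumL : List Carrier → Carrier
  sumL = foldr _+_ 0#

  prodL : List Carrier → Carrier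
  prodL = foldr _*_ 1#

  sum1 : ℕ → (ℕ → Carrier) → Carrier
  sum1 zero f = 0#
  sum1 (suc k) f = sum1 k f + f (suc k)

  sum0 : ℕ → (ℕ → Carrier) → Carrier
  sum0 zero f = f 0
  sum0 (suc k) f = sum0 k f + f (suc k)

  prob : Carrier → Config → Carrier
  prob p cfg = prodL (map (λ { (_ , b) → if b then p else (1# - p) }) cfg)

  EY : Carrier → Carrier → ℕ → Carrier
  EY p t n = sumL (map (λ cfg → prob p cfg * pow t (X n cfg)) (configs n))

  Recurrence : Carrier → Carrier → ℕ → Set ℓ
  Recurrence p t n =
    EY p t n ≈
      sum1 (n ∸ 1) (λ i → t * (pow (1# - p) (i C 2) - pow (1# - p) ((suc i) C 2))
                           * EY p t (n ∸ i))
      + pow (1# - p) (n C 2)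

  -- Formal power series in x over R: coefficient sequences.
  Series : Set c
  Series = ℕ → Carrier

  _·_ : Series → Series → Series
  (f · g) n = sum0 n (λ k → f k * g (n ∸ k))

  oneS : Series
  oneS zero = 1#
  oneS (suc n) = 0#

  xTimes : Series → Series
  xTimes f zero = 0#
  xTimes f (suc n) = f n

  Z : Carrier → Carrier → Series
  Z p t zero = 1#
  Z p t (suc n) = EY p t (suc n)

  A : Carrier → Series
  A p n = pow (1# - p) (n C 2)

  B : Carrier → Series
  B p n = pow (1# - p) ((suc n) C 2)

  Den : Carrier → Carrier → Series
  Den p t n = oneS n - t * (A p n - B p n)

  -- Z = 1 + x B_p / Den, stated as: for the (any) series G inverse to Den,
  -- Z = 1 + x B_p · G coefficientwise.
  GFIdentity : Carrier → Carrier → Set (c ⊔ ℓ)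
  GFIdentity p t =
    (G : Series) → (∀ n → (Den p t · G) n ≈ oneS n) →
    ∀ n → Z p t n ≈ oneS n + (xTimes (B p) · G) n

-- Call {1, …, k} a zero block if every edge inside it has weight 0, and let {1, …, k} be the largest
-- one. If k = n then X_n = 0. Otherwise some edge (a, k+1) with a ≤ k has weight 1; a path collects
-- at most one unit before it reaches {k+1, …, n}, and the path 1 → a → k+1 collects exactly one, so
-- X_n = 1 + X′ where X′ is the maximum weight of a path from k+1 to n. The event that the largest zero
-- block is {1, …, k} has probability (1-p)^C(k,2) - (1-p)^C(k+1,2) and depends only on edges inside
-- {1, …, k+1}, while X′ depends only on edges inside {k+1, …, n} and is distributed as X_{n-k};
-- independence gives the recurrence. Multiplied out, the recurrence says that
-- (1 - t(A - B)) Z = 1 - t(A - B) + xB, and a series with constant term 1 can be cancelled.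

module Submission where

open import Defs
open import Algebra.Bundles using (CommutativeRing)
open import Data.Nat using (ℕ; _≤_)
open import Data.Product using (_×_; _,_)

module Tournament where

  open import Data.Nat using (zero; suc; _+_; _∸_; _<_; z≤n; s≤s; _⊔_; _≡ᵇ_)
  open import Data.Nat.Properties
  open import Data.Bool using (Bool; true; false; if_then_else_; _∧_)
  open import Data.List using (List; []; _∷_; _++_; map; foldr)
  open import Data.List.Properties using (map-∘; map-++; map-cong)
  open import Data.List.Relation.Unary.Any using (here; there)
  open import Data.List.Membership.Propositional using (_∈_; find; lose)
  open import Data.List.Membership.Propositional.Properties
    using (∈-map⁺; ∈-map⁻; ∈-concatMap⁺; ∈-concatMap⁻)
  open import Data.Product using (proj₁; proj₂; ∃)
  open import Data.Sum using (inj₁; inj₂)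
  open import Data.Empty using (⊥-elim)
  open import Relation.Nullary using (¬_)
  open import Relation.Binary.PropositionalEquality

  Weights : Set
  Weights = ℕ → ℕ → ℕ

  Edge : Set
  Edge = ℕ × ℕ

  pathWeightOf : Weights → List ℕ → ℕ
  pathWeightOf w (u ∷ v ∷ vs) = w u v + pathWeightOf w (v ∷ vs)
  pathWeightOf w _ = 0

  maximum : List ℕ → ℕ
  maximum = foldr _⊔_ 0

  maxPathWeight : ℕ → Weights → ℕ
  maxPathWeight n w = maximum (map (pathWeightOf w) (paths n))

  pathWeight≡pathWeightOf : ∀ c vs → pathWeight c vs ≡ pathWeightOf (edgeWeight c) vs
  pathWeight≡pathWeightOf c [] = refl
  pathWeight≡pathWeightOf c (v ∷ []) = refl
  pathWeight≡pathWeightOf c (u ∷ v ∷ vs) = cong (edgeWeight c u v +_) (pathWeight≡pathWeightOf c (v ∷ vs))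

  X≡maxPathWeight : ∀ n c → X n c ≡ maxPathWeight n (edgeWeight c)
  X≡maxPathWeight n c = cong maximum (map-cong (pathWeight≡pathWeightOf c) (paths n))

  maximum-++ : ∀ xs ys → maximum (xs ++ ys) ≡ maximum xs ⊔ maximum ys
  maximum-++ [] ys = refl
  maximum-++ (x ∷ xs) ys = trans (cong (x ⊔_) (maximum-++ xs ys)) (sym (⊔-assoc x (maximum xs) (maximum ys)))

  maximum-map-+ : ∀ {A : Set} k (g : A → ℕ) x xs →
                  maximum (map (λ S → k + g S) (x ∷ xs)) ≡ k + maximum (map g (x ∷ xs))
  maximum-map-+ k g x [] = trans (⊔-identityʳ (k + g x)) (cong (k +_) (sym (⊔-identityʳ (g x))))
  maximum-map-+ k g x (y ∷ ys) =
    trans (cong ((k + g x) ⊔_) (maximum-map-+ k g y ys)) (sym (+-distribˡ-⊔ k (g x) _))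

  subsets-nonEmpty : ∀ l → ∃ λ S → ∃ λ Ss → subsets l ≡ S ∷ Ss
  subsets-nonEmpty [] = [] , [] , refl
  subsets-nonEmpty (x ∷ l) with subsets-nonEmpty l
  ... | S , Ss , eq rewrite eq = x ∷ S , _ , refl

  -- best w a c m is the largest weight of a path from a through some of c, …, c+m-1 to c+m.
  best : Weights → ℕ → ℕ → ℕ → ℕ
  best w a c zero = w a c
  best w a c (suc m) = (w a c + best w c (suc c) m) ⊔ best w a (suc c) m

  -- bestFrom w c r is the largest weight of a path from c to c+r.
  bestFrom : Weights → ℕ → ℕ → ℕ
  bestFrom w c zero = 0
  bestFrom w c (suc r) = best w c (suc c) r

  maximum-subsets≡best : ∀ w b m a c → c + m ≡ b →
    maximum (map (λ S → pathWeightOf w (a ∷ S ++ (b ∷ []))) (subsets (range c m))) ≡ best w a c m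
  maximum-subsets≡best w b zero a c refl rewrite +-identityʳ c = trans (⊔-identityʳ _) (+-identityʳ _)
  maximum-subsets≡best w b (suc m) a c eq = begin
      maximum (map f (map (c ∷_) L ++ L))
    ≡⟨ cong maximum (map-++ f (map (c ∷_) L) L) ⟩
      maximum (map f (map (c ∷_) L) ++ map f L)
    ≡⟨ maximum-++ (map f (map (c ∷_) L)) (map f L) ⟩
      maximum (map f (map (c ∷_) L)) ⊔ maximum (map f L)
    ≡⟨ cong₂ _⊔_ through-c (maximum-subsets≡best w b m a (suc c) eq′) ⟩
      best w a c (suc m) ∎
    where
    open ≡-Reasoning
    L : List (List ℕ)
    L = subsets (range (suc c) m)
    f g : List ℕ → ℕ
    f S = pathWeightOf w (a ∷ S ++ (b ∷ []))
    g S = pathWeightOf w (c ∷ S ++ (b ∷ []))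
    eq′ : suc c + m ≡ b
    eq′ = trans (sym (+-suc c m)) eq
    through-c : maximum (map f (map (c ∷_) L)) ≡ w a c + best w c (suc c) m
    through-c with subsets-nonEmpty (range (suc c) m)
    ... | S , Ss , L≡ = begin
        maximum (map f (map (c ∷_) L))
      ≡⟨ cong maximum (sym (map-∘ L)) ⟩
        maximum (map (λ S → w a c + g S) L)
      ≡⟨ cong (λ z → maximum (map (λ S → w a c + g S) z)) L≡ ⟩
        maximum (map (λ S → w a c + g S) (S ∷ Ss))
      ≡⟨ maximum-map-+ (w a c) g S Ss ⟩
        w a c + maximum (map g (S ∷ Ss))
      ≡⟨ cong (λ z → w a c + maximum (map g z)) (sym L≡) ⟩
        w a c + maximum (map g L)
      ≡⟨ cong (w a c +_) (maximum-subsets≡best w b m c (suc c) eq′) ⟩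
        w a c + best w c (suc c) m ∎

  maxPathWeight≡best : ∀ m w → maxPathWeight (suc (suc m)) w ≡ best w 1 2 m
  maxPathWeight≡best m w =
    trans (cong maximum (sym (map-∘ (subsets (range 2 m))))) (maximum-subsets≡best w (suc (suc m)) m 1 2 refl)

  shift : ℕ → Weights → Weights
  shift k w i j = w (k + i) (k + j)

  best-shift : ∀ k w m a c → best (shift k w) a c m ≡ best w (k + a) (k + c) m
  best-shift k w zero a c = refl
  best-shift k w (suc m) a c
    rewrite best-shift k w m c (suc c) | best-shift k w m a (suc c) | +-suc k c = refl

  maxPathWeight-shift : ∀ k r w → maxPathWeight (suc r) (shift (suc k) w) ≡ bestFrom w (suc (suc k)) r
  maxPathWeight-shift k zero w = refl
  maxPathWeight-shift k (suc r) w
    rewrite maxPathWeight≡best r (shift (suc k) w) | best-shift (suc k) w r 1 2 | +-comm k 1 | +-comm k 2 = refl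

  Binary : Weights → Set
  Binary w = ∀ i j → w i j ≤ 1

  ZeroBlock : ℕ → Weights → Set
  ZeroBlock N w = ∀ i j → 1 ≤ i → i < j → j ≤ N → w i j ≡ 0

  best-≤-suc : ∀ w → Binary w → ∀ m a a′ c → best w a c m ≤ suc (best w a′ c m)
  best-≤-suc w bw zero a a′ c = ≤-trans (bw a c) (s≤s z≤n)
  best-≤-suc w bw (suc m) a a′ c =
    ⊔-lub (≤-trans (+-monoˡ-≤ _ (bw a c)) (s≤s (≤-trans (m≤n+m _ (w a′ c)) (m≤m⊔n _ _))))
          (≤-trans (best-≤-suc w bw m a a′ (suc c)) (s≤s (m≤n⊔m _ _)))

  best-≤-suc-bestFrom : ∀ w → Binary w → ∀ m a c → best w a c m ≤ suc (bestFrom w c m)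
  best-≤-suc-bestFrom w bw zero a c = bw a c
  best-≤-suc-bestFrom w bw (suc m) a c =
    ⊔-lub (+-monoˡ-≤ _ (bw a c)) (best-≤-suc w bw m a c (suc c))

  best-zeroBlock : ∀ w N → ZeroBlock N w → ∀ m a c → 1 ≤ a → a < c → c + m ≡ N → best w a c m ≡ 0
  best-zeroBlock w N zb zero a c 1≤a a<c eq = zb a c 1≤a a<c (≤-reflexive (trans (sym (+-identityʳ c)) eq))
  best-zeroBlock w N zb (suc m) a c 1≤a a<c eq
    rewrite zb a c 1≤a a<c (≤-trans (m≤m+n c (suc m)) (≤-reflexive eq))
          | best-zeroBlock w N zb m c (suc c) (≤-trans 1≤a (<⇒≤ a<c)) ≤-refl (trans (sym (+-suc c m)) eq)
          | best-zeroBlock w N zb m a (suc c) 1≤a (≤-trans a<c (n≤1+n c)) (trans (sym (+-suc c m)) eq) = refl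

  -- A path leaving the zero block {1, …, k} gains at most the single edge on which it leaves.
  best-≤-after-zeroBlock : ∀ w k r → Binary w → ZeroBlock k w → ∀ m a c → 1 ≤ a → a < c → c ≤ suc k →
                           c + m ≡ suc k + r → best w a c m ≤ suc (bestFrom w (suc k) r)
  best-≤-after-zeroBlock w k r bw zb m a c 1≤a a<c c≤k+1 eq with m≤n⇒m<n∨m≡n c≤k+1
  ... | inj₂ refl rewrite +-cancelˡ-≡ (suc k) m r eq = best-≤-suc-bestFrom w bw r a (suc k)
  best-≤-after-zeroBlock w k r bw zb zero a c 1≤a a<c c≤k+1 eq | inj₁ (s≤s c≤k) =
    ⊥-elim (<-irrefl refl (≤-trans (s≤s (≤-trans c≤k (m≤m+n k r))) (≤-reflexive (trans (sym eq) (+-identityʳ c)))))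
  best-≤-after-zeroBlock w k r bw zb (suc m) a c 1≤a a<c c≤k+1 eq | inj₁ (s≤s c≤k)
    rewrite zb a c 1≤a a<c c≤k =
    ⊔-lub (best-≤-after-zeroBlock w k r bw zb m c (suc c) (≤-trans 1≤a (<⇒≤ a<c)) ≤-refl (s≤s c≤k) eq′)
          (best-≤-after-zeroBlock w k r bw zb m a (suc c) 1≤a (≤-trans a<c (n≤1+n c)) (s≤s c≤k) eq′)
    where
    eq′ : suc c + m ≡ suc k + r
    eq′ = trans (sym (+-suc c m)) eq

  best-≥-through : ∀ w m a c j r → c ≤ j → j + r ≡ c + m → w a j + bestFrom w j r ≤ best w a c m
  best-≥-through w zero a c j r c≤j eq with m≤n⇒m<n∨m≡n c≤j
  ... | inj₂ refl rewrite +-cancelˡ-≡ c r 0 eq = ≤-reflexive (+-identityʳ _)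
  ... | inj₁ c<j = ⊥-elim (<-irrefl refl (≤-trans c<j (≤-trans (m≤m+n j r) (≤-reflexive (trans eq (+-identityʳ c))))))
  best-≥-through w (suc m) a c j r c≤j eq with m≤n⇒m<n∨m≡n c≤j
  ... | inj₂ refl rewrite +-cancelˡ-≡ c r (suc m) eq = m≤m⊔n _ _
  ... | inj₁ c<j = ≤-trans (best-≥-through w m a (suc c) j r c<j (trans eq (+-suc c m))) (m≤n⊔m _ _)

  -- The lower bound is witnessed by the path 1 → a → k+2 followed by a best path from k+2.
  best-escape : ∀ w k r a → Binary w → ZeroBlock (suc k) w → 1 ≤ a → a ≤ suc k →
                w a (suc (suc k)) ≡ 1 → best w 1 2 (k + r) ≡ suc (bestFrom w (suc (suc k)) r)
  best-escape w k r a bw zb 1≤a a≤k+1 wa≡1 = ≤-antisym upper lower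
    where
    upper : best w 1 2 (k + r) ≤ suc (bestFrom w (suc (suc k)) r)
    upper = best-≤-after-zeroBlock w (suc k) r bw zb (k + r) 1 2 ≤-refl ≤-refl (s≤s (s≤s z≤n)) refl
    lower : suc (bestFrom w (suc (suc k)) r) ≤ best w 1 2 (k + r)
    lower with m≤n⇒m<n∨m≡n 1≤a
    ... | inj₂ refl = subst (λ z → z + bestFrom w (suc (suc k)) r ≤ best w 1 2 (k + r)) wa≡1
                        (best-≥-through w (k + r) 1 2 (suc (suc k)) r (s≤s (s≤s z≤n)) refl)
    ... | inj₁ 2≤a = ≤-trans via-a (best-≥-through w (k + r) 1 2 a (suc (d + r)) 2≤a eq₁)
      where
      d : ℕ
      d = suc k ∸ a
      a+d : a + d ≡ suc k
      a+d = m+[n∸m]≡n a≤k+1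
      eq₁ : a + suc (d + r) ≡ 2 + (k + r)
      eq₁ = trans (+-suc a (d + r)) (cong suc (trans (sym (+-assoc a d r)) (cong (_+ r) a+d)))
      eq₂ : suc (suc k) + r ≡ suc a + (d + r)
      eq₂ = cong suc (trans (cong (_+ r) (sym a+d)) (+-assoc a d r))
      via-a : suc (bestFrom w (suc (suc k)) r) ≤ w 1 a + best w a (suc a) (d + r)
      via-a = ≤-trans (subst (λ z → z + bestFrom w (suc (suc k)) r ≤ best w a (suc a) (d + r)) wa≡1
                         (best-≥-through w (d + r) a (suc a) (suc (suc k)) r (s≤s a≤k+1) eq₂))
                      (m≤n+m _ (w 1 a))

  zeroColumnᵇ : Weights → ℕ → ℕ → Bool
  zeroColumnᵇ w zero b = true
  zeroColumnᵇ w (suc a) b = zeroColumnᵇ w a b ∧ (w (suc a) b ≡ᵇ 0)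

  zeroBlockᵇ : Weights → ℕ → Bool
  zeroBlockᵇ w zero = true
  zeroBlockᵇ w (suc k) = zeroBlockᵇ w k ∧ zeroColumnᵇ w k (suc k)

  ∧-true-left : ∀ {x y} → x ∧ y ≡ true → x ≡ true
  ∧-true-left {true} e = refl

  ∧-true-right : ∀ {x y} → x ∧ y ≡ true → y ≡ true
  ∧-true-right {true} e = e

  ≡ᵇ0-sound : ∀ n → (n ≡ᵇ 0) ≡ true → n ≡ 0
  ≡ᵇ0-sound zero e = refl

  zeroColumnᵇ-sound : ∀ w a b → zeroColumnᵇ w a b ≡ true → ∀ i → 1 ≤ i → i ≤ a → w i b ≡ 0
  zeroColumnᵇ-sound w zero b e (suc i) 1≤i ()
  zeroColumnᵇ-sound w (suc a) b e i 1≤i i≤a with m≤n⇒m<n∨m≡n i≤a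
  ... | inj₂ refl = ≡ᵇ0-sound _ (∧-true-right {zeroColumnᵇ w a b} e)
  ... | inj₁ (s≤s i≤a′) = zeroColumnᵇ-sound w a b (∧-true-left e) i 1≤i i≤a′

  zeroBlockᵇ-sound : ∀ w k → zeroBlockᵇ w k ≡ true → ZeroBlock k w
  zeroBlockᵇ-sound w zero e i (suc j) 1≤i i<j ()
  zeroBlockᵇ-sound w (suc k) e i j 1≤i i<j j≤k with m≤n⇒m<n∨m≡n j≤k
  ... | inj₂ refl = zeroColumnᵇ-sound w k (suc k) (∧-true-right {zeroBlockᵇ w k} e) i 1≤i (≤-pred i<j)
  ... | inj₁ (s≤s j≤k′) = zeroBlockᵇ-sound w k (∧-true-left e) i j 1≤i i<j j≤k′

  zeroColumnᵇ-false : ∀ w a b → zeroColumnᵇ w a b ≡ false → ∃ λ i → 1 ≤ i × i ≤ a × w i b ≢ 0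
  zeroColumnᵇ-false w (suc a) b e with zeroColumnᵇ w a b in eq
  ... | false with zeroColumnᵇ-false w a b eq
  ...   | i , 1≤i , i≤a , wi≢0 = i , 1≤i , ≤-trans i≤a (n≤1+n a) , wi≢0
  zeroColumnᵇ-false w (suc a) b e | true = suc a , s≤s z≤n , ≤-refl , nonzero e
    where
    nonzero : (w (suc a) b ≡ᵇ 0) ≡ false → w (suc a) b ≢ 0
    nonzero e′ wa≡0 rewrite wa≡0 with e′
    ... | ()

  zeroBlockᵇ-anti : ∀ w k j → j ≤ k → zeroBlockᵇ w k ≡ true → zeroBlockᵇ w j ≡ true
  zeroBlockᵇ-anti w k j j≤k e with m≤n⇒m<n∨m≡n j≤k
  ... | inj₂ refl = e
  zeroBlockᵇ-anti w (suc k) j j≤k e | inj₁ (s≤s j≤k′) = zeroBlockᵇ-anti w k j j≤k′ (∧-true-left e)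

  zeroBlockᵇ-false-mono : ∀ w k j → k ≤ j → zeroBlockᵇ w k ≡ false → zeroBlockᵇ w j ≡ false
  zeroBlockᵇ-false-mono w k j k≤j e with zeroBlockᵇ w j in eq
  ... | false = refl
  ... | true = trans (sym (zeroBlockᵇ-anti w j k k≤j eq)) e

  Binary-nonzero⇒1 : ∀ w i j → Binary w → w i j ≢ 0 → w i j ≡ 1
  Binary-nonzero⇒1 w i j bw ne with w i j | bw i j
  ... | zero | _ = ⊥-elim (ne refl)
  ... | suc zero | _ = refl
  ... | suc (suc _) | s≤s ()

  maxPathWeight-zeroBlock : ∀ n w → zeroBlockᵇ w n ≡ true → maxPathWeight n w ≡ 0
  maxPathWeight-zeroBlock zero w e = refl
  maxPathWeight-zeroBlock (suc zero) w e = refl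
  maxPathWeight-zeroBlock (suc (suc m)) w e =
    trans (maxPathWeight≡best m w) (best-zeroBlock w (suc (suc m)) (zeroBlockᵇ-sound w _ e) m 1 2 ≤-refl ≤-refl refl)

  -- If {1, …, k} is the largest zero block, a best path collects exactly one unit on its way into
  -- {k+1, …, n} and is a best path of the tournament on {k+1, …, n} from then on.
  maxPathWeight-escape : ∀ k n w → 1 ≤ k → k < n → Binary w → zeroBlockᵇ w k ≡ true →
                         zeroBlockᵇ w (suc k) ≡ false → maxPathWeight n w ≡ suc (maxPathWeight (n ∸ k) (shift k w))
  maxPathWeight-escape (suc k) n w _ k<n bw zb zb′
    with zeroColumnᵇ-false w (suc k) (suc (suc k)) (column-false zb zb′)
    where
    column-false : ∀ {x y} → x ≡ true → x ∧ y ≡ false → y ≡ false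
    column-false refl e = e
  ... | a , 1≤a , a≤k+1 , wa≢0 =
    subst (λ z → maxPathWeight z w ≡ suc (maxPathWeight (z ∸ suc k) (shift (suc k) w))) n≡ (begin
        maxPathWeight (suc (suc k) + r) w
      ≡⟨ maxPathWeight≡best (k + r) w ⟩
        best w 1 2 (k + r)
      ≡⟨ best-escape w k r a bw (zeroBlockᵇ-sound w _ zb) 1≤a a≤k+1 (Binary-nonzero⇒1 w a _ bw wa≢0) ⟩
        suc (bestFrom w (suc (suc k)) r)
      ≡⟨ cong suc (sym (maxPathWeight-shift k r w)) ⟩
        suc (maxPathWeight (suc r) (shift (suc k) w))
      ≡⟨ cong (λ z → suc (maxPathWeight z (shift (suc k) w))) (sym (m+n∸m≡n (suc k) (suc r))) ⟩
        suc (maxPathWeight ((suc k + suc r) ∸ suc k) (shift (suc k) w))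
      ≡⟨ cong (λ z → suc (maxPathWeight (z ∸ suc k) (shift (suc k) w))) (+-suc (suc k) r) ⟩
        suc (maxPathWeight ((suc (suc k) + r) ∸ suc k) (shift (suc k) w)) ∎)
    where
    open ≡-Reasoning
    r : ℕ
    r = n ∸ suc (suc k)
    n≡ : suc (suc k) + r ≡ n
    n≡ = m+[n∸m]≡n k<n

  Agree : (ℕ → ℕ → Set) → Weights → Weights → Set
  Agree S w w′ = ∀ i j → S i j → w i j ≡ w′ i j

  Inside : ℕ → ℕ → ℕ → Set
  Inside N i j = 1 ≤ i × i < j × j ≤ N

  best-local : ∀ N v v′ → Agree (Inside N) v v′ → ∀ m a c → 1 ≤ a → a < c → c + m ≤ N →
               best v a c m ≡ best v′ a c m
  best-local N v v′ ag zero a c 1≤a a<c le = ag a c (1≤a , a<c , ≤-trans (m≤m+n c 0) le)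
  best-local N v v′ ag (suc m) a c 1≤a a<c le
    rewrite ag a c (1≤a , a<c , ≤-trans (m≤m+n c (suc m)) le)
          | best-local N v v′ ag m c (suc c) (≤-trans 1≤a (<⇒≤ a<c)) ≤-refl (≤-trans (≤-reflexive (sym (+-suc c m))) le)
          | best-local N v v′ ag m a (suc c) 1≤a (≤-trans a<c (n≤1+n c)) (≤-trans (≤-reflexive (sym (+-suc c m))) le) = refl

  maxPathWeight-local : ∀ N v v′ → Agree (Inside N) v v′ → maxPathWeight N v ≡ maxPathWeight N v′
  maxPathWeight-local zero v v′ ag = refl
  maxPathWeight-local (suc zero) v v′ ag = refl
  maxPathWeight-local (suc (suc m)) v v′ ag =
    trans (maxPathWeight≡best m v) (trans (best-local _ v v′ ag m 1 2 ≤-refl ≤-refl ≤-refl) (sym (maxPathWeight≡best m v′)))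

  zeroColumnᵇ-local : ∀ v v′ a b → Agree (λ i j → j ≡ b × i ≤ a) v v′ → zeroColumnᵇ v a b ≡ zeroColumnᵇ v′ a b
  zeroColumnᵇ-local v v′ zero b ag = refl
  zeroColumnᵇ-local v v′ (suc a) b ag
    rewrite zeroColumnᵇ-local v v′ a b (λ i j (j≡b , i≤a) → ag i j (j≡b , ≤-trans i≤a (n≤1+n a)))
          | ag (suc a) b (refl , ≤-refl) = refl

  zeroBlockᵇ-local : ∀ v v′ k → Agree (λ i j → j ≤ k) v v′ → zeroBlockᵇ v k ≡ zeroBlockᵇ v′ k
  zeroBlockᵇ-local v v′ zero ag = refl
  zeroBlockᵇ-local v v′ (suc k) ag
    rewrite zeroBlockᵇ-local v v′ k (λ i j j≤k → ag i j (≤-trans j≤k (n≤1+n k)))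
          | zeroColumnᵇ-local v v′ k (suc k) (λ i j (j≡k+1 , _) → ag i j (≤-reflexive j≡k+1)) = refl

  ∈-range⁺ : ∀ a k j → a ≤ j → j < a + k → j ∈ range a k
  ∈-range⁺ a zero j a≤j j<a = ⊥-elim (<-irrefl refl (≤-trans j<a (≤-trans (≤-reflexive (+-identityʳ a)) a≤j)))
  ∈-range⁺ a (suc k) j a≤j j<a+k with m≤n⇒m<n∨m≡n a≤j
  ... | inj₂ refl = here refl
  ... | inj₁ a<j = there (∈-range⁺ (suc a) k j a<j (≤-trans j<a+k (≤-reflexive (+-suc a k))))

  ∈-range⁻ : ∀ a k j → j ∈ range a k → a ≤ j × j < a + k
  ∈-range⁻ a (suc k) j (here refl) = ≤-refl , ≤-trans (s≤s (m≤m+n a k)) (≤-reflexive (sym (+-suc a k)))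
  ∈-range⁻ a (suc k) j (there j∈) with ∈-range⁻ (suc a) k j j∈
  ... | a<j , j< = <⇒≤ a<j , ≤-trans j< (≤-reflexive (sym (+-suc a k)))

  ∈-edges⁺ : ∀ n i j → Inside n i j → (i , j) ∈ edges n
  ∈-edges⁺ n i j (1≤i , i<j , j≤n) =
    ∈-concatMap⁺ (λ i → map (λ j → (i , j)) (range (suc i) (n ∸ i))) (lose (∈-range⁺ 1 n i 1≤i (s≤s i≤n))
                       (∈-map⁺ (λ j → (i , j)) (∈-range⁺ (suc i) (n ∸ i) j i<j
                          (s≤s (≤-trans j≤n (≤-reflexive (sym (m+[n∸m]≡n i≤n))))))))
    where
    i≤n : i ≤ n
    i≤n = ≤-trans (<⇒≤ i<j) j≤n

  ∈-edges⁻ : ∀ n i j → (i , j) ∈ edges n → Inside n i j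
  ∈-edges⁻ n i j ij∈ with find (∈-concatMap⁻ (λ i → map (λ j → (i , j)) (range (suc i) (n ∸ i))) {xs = range 1 n} ij∈)
  ... | i′ , i′∈ , ij∈row with ∈-map⁻ (λ j → (i′ , j)) ij∈row | ∈-range⁻ 1 n i′ i′∈
  ... | j′ , j′∈ , refl | 1≤i , i<1+n with ∈-range⁻ (suc i′) (n ∸ i′) j′ j′∈
  ... | i<j , j< = 1≤i , i<j , ≤-pred (≤-trans j< (≤-reflexive (cong suc (m+[n∸m]≡n (≤-pred i<1+n)))))

  hits : ℕ → ℕ → Edge → Bool
  hits i j e = (i ≡ᵇ proj₁ e) ∧ (j ≡ᵇ proj₂ e)

  -- The test is literally the one in edgeWeight, so edgeWeight ((e , b) ∷ c) is set e b (edgeWeight c)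
  -- by definition.
  set : Edge → Bool → Weights → Weights
  set e b w i j = if hits i j e then (if b then 1 else 0) else w i j

  bit : Bool → ℕ
  bit true = 1
  bit false = 0

  ≡ᵇ-sound : ∀ m n → (m ≡ᵇ n) ≡ true → m ≡ n
  ≡ᵇ-sound zero zero e = refl
  ≡ᵇ-sound (suc m) (suc n) e = cong suc (≡ᵇ-sound m n e)

  ≡ᵇ-refl : ∀ m → (m ≡ᵇ m) ≡ true
  ≡ᵇ-refl zero = refl
  ≡ᵇ-refl (suc m) = ≡ᵇ-refl m

  hits-sound : ∀ i j e → hits i j e ≡ true → (i , j) ≡ e
  hits-sound i j (a , b) h with i ≡ᵇ a in i≡a | j ≡ᵇ b in j≡b | h
  ... | true | true | _ = cong₂ _,_ (≡ᵇ-sound i a i≡a) (≡ᵇ-sound j b j≡b)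

  hits-complete : ∀ i j e → hits i j e ≡ false → (i , j) ≢ e
  hits-complete i j e h refl with trans (sym h) (cong₂ _∧_ (≡ᵇ-refl i) (≡ᵇ-refl j))
  ... | ()

  set-hit : ∀ e b w → set e b w (proj₁ e) (proj₂ e) ≡ bit b
  set-hit (i , j) b w rewrite ≡ᵇ-refl i | ≡ᵇ-refl j with b
  ... | true = refl
  ... | false = refl

  set-miss : ∀ e b w i j → (i , j) ≢ e → set e b w i j ≡ w i j
  set-miss e b w i j ne with hits i j e in h
  ... | true = ⊥-elim (ne (hits-sound i j e h))
  ... | false = refl

  set-set : ∀ e b b′ w i j → set e b (set e b′ w) i j ≡ set e b w i j
  set-set e b b′ w i j with hits i j e
  ... | true = refl
  ... | false = refl

  set-comm : ∀ e e′ b b′ w i j → e ≢ e′ → set e b (set e′ b′ w) i j ≡ set e′ b′ (set e b w) i j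
  set-comm e e′ b b′ w i j ne with hits i j e in h | hits i j e′ in h′
  ... | true | true = ⊥-elim (ne (trans (sym (hits-sound i j e h)) (hits-sound i j e′ h′)))
  ... | true | false = refl
  ... | false | true = refl
  ... | false | false = refl

  set-cong : ∀ e b w w′ → (∀ i j → w i j ≡ w′ i j) → ∀ i j → set e b w i j ≡ set e b w′ i j
  set-cong e b w w′ eq i j with hits i j e
  ... | true = refl
  ... | false = eq i j

  set-agree : ∀ S e b w w′ → Agree (λ i j → S i j × (i , j) ≢ e) w w′ → Agree S (set e b w) (set e b w′)
  set-agree S e b w w′ ag i j s with hits i j e in h
  ... | true = refl
  ... | false = ag i j (s , hits-complete i j e h)

  set-outside : ∀ (S : ℕ → ℕ → Set) e b w → ¬ S (proj₁ e) (proj₂ e) → Agree S (set e b w) w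
  set-outside S e b w ¬Se i j s = set-miss e b w i j (λ { refl → ¬Se s })

  Binary-set : ∀ e b w → Binary w → Binary (set e b w)
  Binary-set e b w bw i j with hits i j e | b
  ... | true | true = s≤s z≤n
  ... | true | false = z≤n
  ... | false | _ = bw i j

  ≡ᵇ-+ : ∀ k i a → (k + i ≡ᵇ k + a) ≡ (i ≡ᵇ a)
  ≡ᵇ-+ zero i a = refl
  ≡ᵇ-+ (suc k) i a = ≡ᵇ-+ k i a

  shiftEdge : ℕ → Edge → Edge
  shiftEdge k (i , j) = (k + i , k + j)

  shift-set : ∀ k e b w i j → shift k (set (shiftEdge k e) b w) i j ≡ set e b (shift k w) i j
  shift-set k (a , c) b w i j rewrite ≡ᵇ-+ k i a | ≡ᵇ-+ k j c = refl

module Sums {c ℓ} (R : CommutativeRing c ℓ) where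

  open CommutativeRing R renaming (refl to ≈-refl)
  open Model R
  open import Data.Nat using (zero; suc; z≤n; s≤s)
  import Data.Nat.Properties as ℕ
  open import Data.Sum using (inj₁; inj₂)
  open import Data.List using (List; []; _∷_; map)
  open import Relation.Binary.PropositionalEquality as ≡ using (_≡_; _≢_; refl)
  open import Algebra.Properties.CommutativeSemigroup +-commutativeSemigroup using (interchange)

  sumL-cong : ∀ {A : Set} (f g : A → Carrier) xs → (∀ x → f x ≈ g x) → sumL (map f xs) ≈ sumL (map g xs)
  sumL-cong f g [] h = ≈-refl
  sumL-cong f g (x ∷ xs) h = +-cong (h x) (sumL-cong f g xs h)

  sumL-+ : ∀ {A : Set} (f g : A → Carrier) xs →
           sumL (map (λ x → f x + g x) xs) ≈ sumL (map f xs) + sumL (map g xs)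
  sumL-+ f g [] = sym (+-identityʳ 0#)
  sumL-+ f g (x ∷ xs) = trans (+-congˡ (sumL-+ f g xs)) (interchange _ _ _ _)

  sumL-*ˡ : ∀ {A : Set} k (f : A → Carrier) xs → sumL (map (λ x → k * f x) xs) ≈ k * sumL (map f xs)
  sumL-*ˡ k f [] = sym (zeroʳ k)
  sumL-*ˡ k f (x ∷ xs) = trans (+-congˡ (sumL-*ˡ k f xs)) (sym (distribˡ k _ _))

  sum1-cong : ∀ m f g → (∀ i → 1 ≤ i → i ≤ m → f i ≈ g i) → sum1 m f ≈ sum1 m g
  sum1-cong zero f g h = ≈-refl
  sum1-cong (suc m) f g h =
    +-cong (sum1-cong m f g (λ i 1≤i i≤m → h i 1≤i (ℕ.≤-trans i≤m (ℕ.n≤1+n m)))) (h (suc m) (s≤s z≤n) ℕ.≤-refl)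

  sum1-zero : ∀ m f → (∀ i → 1 ≤ i → i ≤ m → f i ≈ 0#) → sum1 m f ≈ 0#
  sum1-zero m f h = trans (sum1-cong m f (λ _ → 0#) h) (zeros m)
    where
    zeros : ∀ m → sum1 m (λ _ → 0#) ≈ 0#
    zeros zero = ≈-refl
    zeros (suc m) = trans (+-identityʳ _) (zeros m)

  sum1-single : ∀ m f k → 1 ≤ k → k ≤ m → (∀ i → 1 ≤ i → i ≤ m → i ≢ k → f i ≈ 0#) → sum1 m f ≈ f k
  sum1-single zero f (suc k) _ () _
  sum1-single (suc m) f k 1≤k k≤m h with ℕ.m≤n⇒m<n∨m≡n k≤m
  ... | inj₂ refl =
    trans (+-congʳ (sum1-zero m f (λ i 1≤i i≤m → h i 1≤i (ℕ.≤-trans i≤m (ℕ.n≤1+n m)) (λ { refl → ℕ.<-irrefl refl (s≤s i≤m) }))))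
          (+-identityˡ _)
  ... | inj₁ (s≤s k≤m′) =
    trans (+-cong (sum1-single m f k 1≤k k≤m′ (λ i 1≤i i≤m → h i 1≤i (ℕ.≤-trans i≤m (ℕ.n≤1+n m))))
                  (h (suc m) (s≤s z≤n) ℕ.≤-refl (λ { refl → ℕ.<-irrefl refl (s≤s k≤m′) })))
          (+-identityʳ _)

module Expectation {c ℓ} (R : CommutativeRing c ℓ) (p : CommutativeRing.Carrier R) where

  open Tournament
  open import Tactic.RingSolver using (solve-∀)
  open import Tactic.RingSolver.Core.AlmostCommutativeRing using (AlmostCommutativeRing; fromCommutativeRing)
  open import Data.Maybe using (nothing)

  almostRing : AlmostCommutativeRing c ℓ
  almostRing = fromCommutativeRing R (λ _ → nothing)

  module Identities where
    open AlmostCommutativeRing almostRing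

    mixture-+ : ∀ x y a b c d → x * (a + b) + y * (c + d) ≈ (x * a + y * c) + (x * b + y * d)
    mixture-+ = solve-∀ almostRing

    mixture-* : ∀ x y k a c → x * (k * a) + y * (k * c) ≈ k * (x * a + y * c)
    mixture-* = solve-∀ almostRing

    mixture-swap : ∀ x y a b c d →
      x * (x * a + y * b) + y * (x * c + y * d) ≈ x * (x * a + y * c) + y * (x * b + y * d)
    mixture-swap = solve-∀ almostRing

  open Identities
  open CommutativeRing R renaming (refl to ≈-refl)
  open Model R
  open Sums R
  open import Data.Nat using (zero; suc; _∸_; _<_; z≤n; s≤s; _≡ᵇ_) renaming (_+_ to _+ℕ_)
  import Data.Nat.Properties as ℕ
  open import Data.Nat.Combinatorics using (_C_; nC1≡n; nCk+nC[k+1]≡[n+1]C[k+1])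
  open import Data.Bool using (Bool; true; false; _∧_)
  open import Data.List using (List; []; _∷_; map; zip; length; concatMap)
  open import Data.List.Relation.Unary.Any using (here; there)
  open import Data.List.Membership.Propositional using (_∈_)
  open import Data.Product using (proj₁; proj₂)
  open import Data.Product.Properties using (≡-dec)
  open import Data.List.Membership.Propositional.Properties using (∈-map⁺; ∈-map⁻)
  open import Data.Empty using (⊥; ⊥-elim)
  open import Relation.Nullary using (¬_; yes; no)
  open import Relation.Binary.Definitions using (Decidable; DecidableEquality)
  open import Relation.Binary.PropositionalEquality as ≡ using (_≡_; _≢_; refl)
  open import Relation.Binary.Reasoning.Setoid setoid
  open import Algebra.Properties.Ring ring using (-‿distribʳ-*)
  open import Algebra.Properties.AbelianGroup +-abelianGroup using (⁻¹-∙-comm)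

  q : Carrier
  q = 1# - p

  p+q≈1 : p + q ≈ 1#
  p+q≈1 = begin
    p + (1# + - p) ≈⟨ +-comm p _ ⟩
    (1# + - p) + p ≈⟨ +-assoc 1# (- p) p ⟩
    1# + (- p + p) ≈⟨ +-congˡ (-‿inverseˡ p) ⟩
    1# + 0#        ≈⟨ +-identityʳ 1# ⟩
    1#             ∎

  p*x+q*x≈x : ∀ x → p * x + q * x ≈ x
  p*x+q*x≈x x = begin
    p * x + q * x ≈⟨ sym (distribʳ x p q) ⟩
    (p + q) * x   ≈⟨ *-congʳ p+q≈1 ⟩
    1# * x        ≈⟨ *-identityˡ x ⟩
    x             ∎

  mixture-*ʳ : ∀ x y a b k → x * (a * k) + y * (b * k) ≈ (x * a + y * b) * k
  mixture-*ʳ x y a b k = sym (trans (distribʳ k (x * a) (y * b)) (+-cong (*-assoc x a k) (*-assoc y b k)))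

  𝟙 : Bool → Carrier
  𝟙 true = 1#
  𝟙 false = 0#

  𝟙-∧ : ∀ x y → 𝟙 (x ∧ y) ≈ 𝟙 x * 𝟙 y
  𝟙-∧ true y = sym (*-identityˡ _)
  𝟙-∧ false y = sym (zeroˡ _)

  Extensional : (Weights → Carrier) → Set ℓ
  Extensional F = ∀ w w′ → (∀ i j → w i j ≡ w′ i j) → F w ≈ F w′

  DependsOn : (ℕ → ℕ → Set) → (Weights → Carrier) → Set ℓ
  DependsOn S F = ∀ w w′ → Agree S w w′ → F w ≈ F w′

  DependsOn⇒Extensional : ∀ S F → DependsOn S F → Extensional F
  DependsOn⇒Extensional S F d w w′ eq = d w w′ (λ i j _ → eq i j)

  set-Extensional : ∀ F e b → Extensional F → Extensional (λ w → F (set e b w))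
  set-Extensional F e b ext w w′ eq = ext _ _ (set-cong e b w w′ eq)

  set-DependsOn : ∀ S F e b → DependsOn S F → DependsOn S (λ w → F (set e b w))
  set-DependsOn S F e b d w w′ ag = d _ _ (set-agree S e b w w′ (λ i j (s , _) → ag i j s))

  set-irrelevant : ∀ S F e b → DependsOn S F → ¬ S (proj₁ e) (proj₂ e) → ∀ w → F (set e b w) ≈ F w
  set-irrelevant S F e b d ¬Se w = d _ _ (set-outside S e b w ¬Se)

  -- 𝔼 es F is the expectation of F when the edges in es carry independent B(p) weights and all other
  -- weights are 0.
  𝔼 : List Edge → (Weights → Carrier) → Carrier
  𝔼 [] F = F (λ _ _ → 0)
  𝔼 (e ∷ es) F = p * 𝔼 es (λ w → F (set e true w)) + q * 𝔼 es (λ w → F (set e false w))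

  𝔼-cong-Binary : ∀ es F G → (∀ w → Binary w → F w ≈ G w) → 𝔼 es F ≈ 𝔼 es G
  𝔼-cong-Binary [] F G h = h _ (λ i j → z≤n)
  𝔼-cong-Binary (e ∷ es) F G h =
    +-cong (*-congˡ (𝔼-cong-Binary es _ _ (λ w bw → h _ (Binary-set e true w bw))))
           (*-congˡ (𝔼-cong-Binary es _ _ (λ w bw → h _ (Binary-set e false w bw))))

  𝔼-cong : ∀ es F G → (∀ w → F w ≈ G w) → 𝔼 es F ≈ 𝔼 es G
  𝔼-cong es F G h = 𝔼-cong-Binary es F G (λ w _ → h w)

  𝔼-const : ∀ es k → 𝔼 es (λ _ → k) ≈ k
  𝔼-const [] k = ≈-refl
  𝔼-const (e ∷ es) k = trans (+-cong (*-congˡ (𝔼-const es k)) (*-congˡ (𝔼-const es k))) (p*x+q*x≈x k)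

  𝔼-+ : ∀ es F G → 𝔼 es (λ w → F w + G w) ≈ 𝔼 es F + 𝔼 es G
  𝔼-+ [] F G = ≈-refl
  𝔼-+ (e ∷ es) F G = trans (+-cong (*-congˡ (𝔼-+ es _ _)) (*-congˡ (𝔼-+ es _ _))) (mixture-+ p q _ _ _ _)

  𝔼-*ˡ : ∀ es k F → 𝔼 es (λ w → k * F w) ≈ k * 𝔼 es F
  𝔼-*ˡ [] k F = ≈-refl
  𝔼-*ˡ (e ∷ es) k F = trans (+-cong (*-congˡ (𝔼-*ˡ es k _)) (*-congˡ (𝔼-*ˡ es k _))) (mixture-* p q k _ _)

  𝔼-neg : ∀ es F → 𝔼 es (λ w → - F w) ≈ - 𝔼 es F
  𝔼-neg [] F = ≈-refl
  𝔼-neg (e ∷ es) F = begin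
    p * 𝔼 es (λ w → - F (set e true w)) + q * 𝔼 es (λ w → - F (set e false w))
      ≈⟨ +-cong (*-congˡ (𝔼-neg es _)) (*-congˡ (𝔼-neg es _)) ⟩
    p * (- E₁) + q * (- E₀)   ≈⟨ +-cong (sym (-‿distribʳ-* p E₁)) (sym (-‿distribʳ-* q E₀)) ⟩
    - (p * E₁) + - (q * E₀)   ≈⟨ ⁻¹-∙-comm (p * E₁) (q * E₀) ⟩
    - (p * E₁ + q * E₀)       ∎
    where
    E₁ E₀ : Carrier
    E₁ = 𝔼 es (λ w → F (set e true w))
    E₀ = 𝔼 es (λ w → F (set e false w))

  𝔼-minus : ∀ es F G → 𝔼 es (λ w → F w - G w) ≈ 𝔼 es F - 𝔼 es G
  𝔼-minus es F G = trans (𝔼-+ es F (λ w → - G w)) (+-congˡ (𝔼-neg es G))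

  𝔼-sum1 : ∀ es m (f : ℕ → Weights → Carrier) → 𝔼 es (λ w → sum1 m (λ i → f i w)) ≈ sum1 m (λ i → 𝔼 es (f i))
  𝔼-sum1 es zero f = 𝔼-const es 0#
  𝔼-sum1 es (suc m) f = trans (𝔼-+ es _ _) (+-congʳ (𝔼-sum1 es m f))

  𝔼-∷-irrelevant : ∀ e es F → (∀ b w → F (set e b w) ≈ F w) → 𝔼 (e ∷ es) F ≈ 𝔼 es F
  𝔼-∷-irrelevant e es F h =
    trans (+-cong (*-congˡ (𝔼-cong es _ _ (h true))) (*-congˡ (𝔼-cong es _ _ (h false)))) (p*x+q*x≈x _)

  _≟ᴱ_ : DecidableEquality Edge
  _≟ᴱ_ = ≡-dec ℕ._≟_ ℕ._≟_

  -- The outcome of any e ∈ es can be drawn first: updates of distinct edges commute, and a second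
  -- update of e overrides the first.
  𝔼-condition : ∀ es e F → Extensional F → e ∈ es →
                𝔼 es F ≈ p * 𝔼 es (λ w → F (set e true w)) + q * 𝔼 es (λ w → F (set e false w))
  𝔼-condition (x ∷ xs) e F ext e∈ with x ≟ᴱ e
  ... | yes refl = sym (+-cong (*-congˡ (forget true)) (*-congˡ (forget false)))
    where
    forget : ∀ b → 𝔼 (x ∷ xs) (λ w → F (set x b w)) ≈ 𝔼 xs (λ w → F (set x b w))
    forget b = 𝔼-∷-irrelevant x xs _ (λ b′ w → ext _ _ (set-set x b b′ w))
  ... | no x≢e with e∈
  ...   | here e≡x = ⊥-elim (x≢e (≡.sym e≡x))
  ...   | there e∈xs =
    trans (+-cong (*-congˡ (𝔼-condition xs e _ (set-Extensional F x true ext) e∈xs))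
                  (*-congˡ (𝔼-condition xs e _ (set-Extensional F x false ext) e∈xs)))
   (trans (mixture-swap p q _ _ _ _)
          (+-cong (*-congˡ (+-cong (*-congˡ (commute true true)) (*-congˡ (commute false true))))
                  (*-congˡ (+-cong (*-congˡ (commute true false)) (*-congˡ (commute false false))))))
    where
    commute : ∀ b′ b → 𝔼 xs (λ w → F (set x b′ (set e b w))) ≈ 𝔼 xs (λ w → F (set e b (set x b′ w)))
    commute b′ b = 𝔼-cong xs _ _ (λ w → ext _ _ (λ i j → set-comm x e b′ b w i j x≢e))

  𝔼-drop : ∀ S es F → DependsOn S F → (∀ i j → S i j → (i , j) ∈ es → ⊥) → 𝔼 es F ≈ 𝔼 [] F
  𝔼-drop S [] F d h = ≈-refl
  𝔼-drop S (x ∷ xs) F d h =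
    trans (𝔼-∷-irrelevant x xs F (λ b w → set-irrelevant S F x b d (λ s → h _ _ s (here refl)) w))
          (𝔼-drop S xs F d (λ i j s ij∈ → h i j s (there ij∈)))

  -- Edges outside S can be added to or dropped from the list freely.
  𝔼-support : ∀ S → Decidable S → ∀ es′ es F → DependsOn S F → (∀ e → e ∈ es′ → e ∈ es) →
              (∀ i j → S i j → (i , j) ∈ es → (i , j) ∈ es′) → 𝔼 es F ≈ 𝔼 es′ F
  𝔼-support S S? [] es F d sub sup = 𝔼-drop S es F d (λ i j s ij∈ → ∉[] (sup i j s ij∈))
    where ∉[] : ∀ {x : Edge} → x ∈ [] → ⊥
          ∉[] ()
  𝔼-support S S? (x ∷ xs) es F d sub sup with S? (proj₁ x) (proj₂ x)
  ... | no ¬Sx = trans (𝔼-support S S? xs es F d (λ e e∈ → sub e (there e∈)) sup′)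
                       (sym (𝔼-∷-irrelevant x xs F (λ b w → set-irrelevant S F x b d ¬Sx w)))
    where
    sup′ : ∀ i j → S i j → (i , j) ∈ es → (i , j) ∈ xs
    sup′ i j s ij∈ with sup i j s ij∈
    ... | here refl = ⊥-elim (¬Sx s)
    ... | there ij∈xs = ij∈xs
  ... | yes Sx =
    trans (𝔼-condition es x F (DependsOn⇒Extensional S F d) (sub x (here refl)))
          (+-cong (*-congˡ (𝔼-support S′ S′? xs es _ (d′ true) (λ e e∈ → sub e (there e∈)) sup′))
                  (*-congˡ (𝔼-support S′ S′? xs es _ (d′ false) (λ e e∈ → sub e (there e∈)) sup′)))
    where
    S′ : ℕ → ℕ → Set
    S′ i j = S i j × (i , j) ≢ x
    S′? : Decidable S′
    S′? i j with S? i j | (i , j) ≟ᴱ x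
    ... | yes s | no ne = yes (s , ne)
    ... | yes s | yes eq = no (λ z → proj₂ z eq)
    ... | no ¬s | _ = no (λ z → ¬s (proj₁ z))
    d′ : ∀ b → DependsOn S′ (λ w → F (set x b w))
    d′ b w w′ ag = d _ _ (set-agree S x b w w′ ag)
    sup′ : ∀ i j → S′ i j → (i , j) ∈ es → (i , j) ∈ xs
    sup′ i j (s , ne) ij∈ with sup i j s ij∈
    ... | here eq = ⊥-elim (ne eq)
    ... | there ij∈xs = ij∈xs

  𝔼-independent : ∀ S T → Decidable S → (∀ i j → S i j → T i j → ⊥) → ∀ es F G →
                  DependsOn S F → DependsOn T G → 𝔼 es (λ w → F w * G w) ≈ 𝔼 es F * 𝔼 es G
  𝔼-independent S T S? disjoint [] F G dF dG = ≈-refl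
  𝔼-independent S T S? disjoint (x ∷ xs) F G dF dG with S? (proj₁ x) (proj₂ x)
  ... | yes Sx =
    trans (+-cong (*-congˡ (𝔼-cong xs _ _ (λ w → *-congˡ (G-irrelevant true w))))
                  (*-congˡ (𝔼-cong xs _ _ (λ w → *-congˡ (G-irrelevant false w)))))
   (trans (+-cong (*-congˡ (𝔼-independent S T S? disjoint xs _ G (set-DependsOn S F x true dF) dG))
                  (*-congˡ (𝔼-independent S T S? disjoint xs _ G (set-DependsOn S F x false dF) dG)))
   (trans (mixture-*ʳ p q _ _ _) (*-congˡ (sym (𝔼-∷-irrelevant x xs G G-irrelevant)))))
    where
    G-irrelevant : ∀ b w → G (set x b w) ≈ G w
    G-irrelevant b w = set-irrelevant T G x b dG (disjoint _ _ Sx) w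
  ... | no ¬Sx =
    trans (+-cong (*-congˡ (𝔼-cong xs _ _ (λ w → *-congʳ (F-irrelevant true w))))
                  (*-congˡ (𝔼-cong xs _ _ (λ w → *-congʳ (F-irrelevant false w)))))
   (trans (+-cong (*-congˡ (𝔼-independent S T S? disjoint xs F _ dF (set-DependsOn T G x true dG)))
                  (*-congˡ (𝔼-independent S T S? disjoint xs F _ dF (set-DependsOn T G x false dG))))
   (trans (mixture-* p q _ _ _) (*-congʳ (sym (𝔼-∷-irrelevant x xs F F-irrelevant)))))
    where
    F-irrelevant : ∀ b w → F (set x b w) ≈ F w
    F-irrelevant b w = set-irrelevant S F x b dF ¬Sx w

  𝔼-shift : ∀ k es G → Extensional G → 𝔼 (map (shiftEdge k) es) (λ w → G (shift k w)) ≈ 𝔼 es G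
  𝔼-shift k [] G ext = ≈-refl
  𝔼-shift k (e ∷ es) G ext = +-cong (*-congˡ (shifted true)) (*-congˡ (shifted false))
    where
    shifted : ∀ b → 𝔼 (map (shiftEdge k) es) (λ w → G (shift k (set (shiftEdge k e) b w)))
                  ≈ 𝔼 es (λ w → G (set e b w))
    shifted b = trans (𝔼-cong (map (shiftEdge k) es) _ _ (λ w → ext _ _ (shift-set k e b w)))
                      (𝔼-shift k es _ (set-Extensional G e b ext))

  𝟙-Extensional : ∀ (f : Weights → Bool) → (∀ w w′ → (∀ i j → w i j ≡ w′ i j) → f w ≡ f w′) →
                  Extensional (λ w → 𝟙 (f w))
  𝟙-Extensional f h w w′ eq = reflexive (≡.cong 𝟙 (h w w′ eq))

  𝔼-edgeZero : ∀ es e → e ∈ es → 𝔼 es (λ w → 𝟙 (w (proj₁ e) (proj₂ e) ≡ᵇ 0)) ≈ q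
  𝔼-edgeZero es e e∈ = begin
      𝔼 es (λ w → 𝟙 (w (proj₁ e) (proj₂ e) ≡ᵇ 0))
    ≈⟨ 𝔼-condition es e _ (𝟙-Extensional _ (λ w w′ eq → ≡.cong (_≡ᵇ 0) (eq _ _))) e∈ ⟩
      p * 𝔼 es (λ w → zero? (set e true w)) + q * 𝔼 es (λ w → zero? (set e false w))
    ≈⟨ +-cong (*-congˡ (outcome true)) (*-congˡ (outcome false)) ⟩
      p * 0# + q * 1#
    ≈⟨ trans (+-cong (zeroʳ p) (*-identityʳ q)) (+-identityˡ q) ⟩
      q ∎
    where
    zero? : Weights → Carrier
    zero? w = 𝟙 (w (proj₁ e) (proj₂ e) ≡ᵇ 0)
    outcome : ∀ b → 𝔼 es (λ w → zero? (set e b w)) ≈ 𝟙 (bit b ≡ᵇ 0)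
    outcome b = trans (𝔼-cong es _ _ (λ w → reflexive (≡.cong (λ z → 𝟙 (z ≡ᵇ 0)) (set-hit e b w))))
                      (𝔼-const es _)

  𝔼-zeroColumn : ∀ es a b → (∀ i → 1 ≤ i → i ≤ a → (i , b) ∈ es) → 𝔼 es (λ w → 𝟙 (zeroColumnᵇ w a b)) ≈ pow q a
  𝔼-zeroColumn es zero b h = 𝔼-const es 1#
  𝔼-zeroColumn es (suc a) b h =
    trans (𝔼-cong es _ _ (λ w → 𝟙-∧ (zeroColumnᵇ w a b) _))
    (trans (𝔼-independent S T S? disjoint es _ _ dF dG)
    (trans (*-cong (𝔼-zeroColumn es a b (λ i 1≤i i≤a → h i 1≤i (ℕ.≤-trans i≤a (ℕ.n≤1+n a))))
                   (𝔼-edgeZero es (suc a , b) (h (suc a) (s≤s z≤n) ℕ.≤-refl)))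
           (*-comm _ _)))
    where
    S T : ℕ → ℕ → Set
    S i j = j ≡ b × i ≤ a
    T i j = i ≡ suc a × j ≡ b
    S? : Decidable S
    S? i j with j ℕ.≟ b | i ℕ.≤? a
    ... | yes e₁ | yes e₂ = yes (e₁ , e₂)
    ... | no ¬e₁ | _ = no (λ z → ¬e₁ (proj₁ z))
    ... | yes _ | no ¬e₂ = no (λ z → ¬e₂ (proj₂ z))
    disjoint : ∀ i j → S i j → T i j → ⊥
    disjoint i j (_ , i≤a) (refl , _) = ℕ.<-irrefl refl i≤a
    dF : DependsOn S (λ w → 𝟙 (zeroColumnᵇ w a b))
    dF w w′ ag = reflexive (≡.cong 𝟙 (zeroColumnᵇ-local w w′ a b ag))
    dG : DependsOn T (λ w → 𝟙 (w (suc a) b ≡ᵇ 0))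
    dG w w′ ag = reflexive (≡.cong (λ z → 𝟙 (z ≡ᵇ 0)) (ag (suc a) b (refl , refl)))

  pow-+ : ∀ x m n → pow x (m +ℕ n) ≈ pow x m * pow x n
  pow-+ x zero n = sym (*-identityˡ _)
  pow-+ x (suc m) n = trans (*-congˡ (pow-+ x m n)) (sym (*-assoc _ _ _))

  [1+k]C2≡k+kC2 : ∀ k → suc k C 2 ≡ k +ℕ k C 2
  [1+k]C2≡k+kC2 k = ≡.trans (≡.sym (nCk+nC[k+1]≡[n+1]C[k+1] k 1)) (≡.cong (_+ℕ k C 2) (nC1≡n k))

  𝔼-zeroBlock : ∀ es k → (∀ i j → Inside k i j → (i , j) ∈ es) → 𝔼 es (λ w → 𝟙 (zeroBlockᵇ w k)) ≈ pow q (k C 2)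
  𝔼-zeroBlock es zero h = 𝔼-const es 1#
  𝔼-zeroBlock es (suc k) h =
    trans (𝔼-cong es _ _ (λ w → 𝟙-∧ (zeroBlockᵇ w k) _))
    (trans (𝔼-independent S T S? disjoint es _ _ dF dG)
    (trans (*-cong (𝔼-zeroBlock es k (λ i j (1≤i , i<j , j≤k) → h i j (1≤i , i<j , ℕ.≤-trans j≤k (ℕ.n≤1+n k))))
                   (𝔼-zeroColumn es k (suc k) (λ i 1≤i i≤k → h i (suc k) (1≤i , s≤s i≤k , ℕ.≤-refl))))
    (trans (*-comm _ _) (trans (sym (pow-+ q k (k C 2))) (reflexive (≡.cong (pow q) (≡.sym ([1+k]C2≡k+kC2 k))))))))
    where
    S T : ℕ → ℕ → Set
    S i j = j ≤ k
    T i j = j ≡ suc k × i ≤ k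
    S? : Decidable S
    S? i j = j ℕ.≤? k
    disjoint : ∀ i j → S i j → T i j → ⊥
    disjoint i j j≤k (refl , _) = ℕ.<-irrefl refl j≤k
    dF : DependsOn S (λ w → 𝟙 (zeroBlockᵇ w k))
    dF w w′ ag = reflexive (≡.cong 𝟙 (zeroBlockᵇ-local w w′ k ag))
    dG : DependsOn T (λ w → 𝟙 (zeroColumnᵇ w k (suc k)))
    dG w w′ ag = reflexive (≡.cong 𝟙 (zeroColumnᵇ-local w w′ k (suc k) (λ i j (j≡ , i≤) → ag i j (j≡ , i≤))))

  sumL-allBools : ∀ (h : List Bool → Carrier) k →
    sumL (map h (allBools (suc k))) ≈ sumL (map (λ bs → h (true ∷ bs) + h (false ∷ bs)) (allBools k))
  sumL-allBools h k = go (allBools k)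
    where
    go : ∀ bss → sumL (map h (concatMap (λ bs → (true ∷ bs) ∷ (false ∷ bs) ∷ []) bss))
               ≈ sumL (map (λ bs → h (true ∷ bs) + h (false ∷ bs)) bss)
    go [] = ≈-refl
    go (bs ∷ bss) = trans (sym (+-assoc _ _ _)) (+-congˡ (go bss))

  sum-configs≈𝔼 : ∀ es F →
    sumL (map (λ bs → prob p (zip es bs) * F (edgeWeight (zip es bs))) (allBools (length es))) ≈ 𝔼 es F
  sum-configs≈𝔼 [] F = trans (+-identityʳ _) (*-identityˡ _)
  sum-configs≈𝔼 (e ∷ es) F =
    trans (sumL-allBools _ (length es))
    (trans (sumL-cong _ (λ bs → p * (prob p (zip es bs) * F (set e true (edgeWeight (zip es bs))))
                              + q * (prob p (zip es bs) * F (set e false (edgeWeight (zip es bs)))))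
                      (allBools (length es)) (λ bs → +-cong (*-assoc _ _ _) (*-assoc _ _ _)))
    (trans (sumL-+ _ _ (allBools (length es)))
    (+-cong (trans (sumL-*ˡ p _ (allBools (length es))) (*-congˡ (sum-configs≈𝔼 es _)))
            (trans (sumL-*ˡ q _ (allBools (length es))) (*-congˡ (sum-configs≈𝔼 es _))))))

  -- The edges among {i+1, …, n} form a copy of the tournament on n ∸ i vertices.
  𝔼-restrict : ∀ n i G → i ≤ n → DependsOn (Inside (n ∸ i)) G →
               𝔼 (edges n) (λ w → G (shift i w)) ≈ 𝔼 (edges (n ∸ i)) G
  𝔼-restrict n i G i≤n dG =
    trans (𝔼-support S S? (map (shiftEdge i) (edges (n ∸ i))) (edges n) _ dG′ sub sup)
          (𝔼-shift i (edges (n ∸ i)) G (DependsOn⇒Extensional _ G dG))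
    where
    S : ℕ → ℕ → Set
    S a b = suc i ≤ a × a < b × b ≤ n
    S? : Decidable S
    S? a b with suc i ℕ.≤? a | suc a ℕ.≤? b | b ℕ.≤? n
    ... | yes x | yes y | yes z = yes (x , y , z)
    ... | no ¬x | _ | _ = no (λ u → ¬x (proj₁ u))
    ... | yes _ | no ¬y | _ = no (λ u → ¬y (proj₁ (proj₂ u)))
    ... | yes _ | yes _ | no ¬z = no (λ u → ¬z (proj₂ (proj₂ u)))
    i+b≤n : ∀ {b} → b ≤ n ∸ i → i +ℕ b ≤ n
    i+b≤n b≤ = ℕ.≤-trans (ℕ.+-monoʳ-≤ i b≤) (ℕ.≤-reflexive (ℕ.m+[n∸m]≡n i≤n))
    dG′ : DependsOn S (λ w → G (shift i w))
    dG′ w w′ ag = dG _ _ (λ a b (1≤a , a<b , b≤) →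
      ag (i +ℕ a) (i +ℕ b) (ℕ.≤-trans (ℕ.≤-reflexive (ℕ.+-comm 1 i)) (ℕ.+-monoʳ-≤ i 1≤a) , ℕ.+-monoʳ-< i a<b , i+b≤n b≤))
    sub : ∀ e → e ∈ map (shiftEdge i) (edges (n ∸ i)) → e ∈ edges n
    sub e e∈ with ∈-map⁻ (shiftEdge i) e∈
    ... | (a , b) , ab∈ , refl with ∈-edges⁻ (n ∸ i) a b ab∈
    ... | 1≤a , a<b , b≤ = ∈-edges⁺ n (i +ℕ a) (i +ℕ b) (ℕ.≤-trans 1≤a (ℕ.m≤n+m a i) , ℕ.+-monoʳ-< i a<b , i+b≤n b≤)
    sup : ∀ a b → S a b → (a , b) ∈ edges n → (a , b) ∈ map (shiftEdge i) (edges (n ∸ i))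
    sup a b (i<a , a<b , b≤n) _ =
      ≡.subst (_∈ map (shiftEdge i) (edges (n ∸ i)))
        (≡.cong₂ _,_ (ℕ.m+[n∸m]≡n i≤a) (ℕ.m+[n∸m]≡n i≤b))
        (∈-map⁺ (shiftEdge i) (∈-edges⁺ (n ∸ i) (a ∸ i) (b ∸ i)
           (ℕ.≤-trans (ℕ.≤-reflexive (≡.sym (ℕ.m+n∸m≡n i 1))) (ℕ.∸-monoˡ-≤ i (ℕ.≤-trans (ℕ.≤-reflexive (ℕ.+-comm i 1)) i<a))
           , ℕ.∸-monoˡ-< a<b i≤a
           , ℕ.∸-monoˡ-≤ i b≤n)))
      where
      i≤a : i ≤ a
      i≤a = ℕ.<⇒≤ i<a
      i≤b : i ≤ b
      i≤b = ℕ.≤-trans i≤a (ℕ.<⇒≤ a<b)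

module Recurrence {c ℓ} (R : CommutativeRing c ℓ) (p t : CommutativeRing.Carrier R) where

  open Tournament
  open CommutativeRing R renaming (refl to ≈-refl)
  open Model R
  open Sums R
  open Expectation R p
  open import Data.Nat using (zero; suc; _∸_; _<_; z≤n; s≤s) renaming (_+_ to _+ℕ_)
  import Data.Nat.Properties as ℕ
  open import Data.Nat.Combinatorics using (_C_)
  open import Data.Bool using (true; false)
  open import Data.List using (zip; length)
  open import Data.List.Properties using (map-∘)
  open import Data.List.Membership.Propositional using (_∈_)
  open import Data.Product using (_,_)
  open import Data.Empty using (⊥; ⊥-elim)
  open import Relation.Binary using (tri<; tri≈; tri>)
  open import Relation.Binary.Definitions using (Decidable)
  open import Relation.Binary.PropositionalEquality as ≡ using (_≡_; _≢_; refl)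
  open import Relation.Binary.Reasoning.Setoid setoid
  open import Algebra.Properties.Ring ring using (-0#≈0#)

  EY≈𝔼 : ∀ n → EY p t n ≈ 𝔼 (edges n) (λ w → pow t (maxPathWeight n w))
  EY≈𝔼 n =
    trans (reflexive (≡.cong sumL (≡.sym (map-∘ (allBools (length (edges n)))))))
    (trans (sumL-cong _ _ (allBools (length (edges n)))
             (λ bs → reflexive (≡.cong (λ x → prob p (zip (edges n) bs) * pow t x) (X≡maxPathWeight n (zip (edges n) bs)))))
           (sum-configs≈𝔼 (edges n) _))

  -- Nonzero only when {1, …, i} is the largest zero block, in which case it is t ^ X_n.
  term : ℕ → Weights → ℕ → Carrier
  term n w i = t * (𝟙 (zeroBlockᵇ w i) - 𝟙 (zeroBlockᵇ w (suc i))) * pow t (maxPathWeight (n ∸ i) (shift i w))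

  term-vanishes : ∀ n w i x → zeroBlockᵇ w i ≡ x → zeroBlockᵇ w (suc i) ≡ x → term n w i ≈ 0#
  term-vanishes n w i x zb zb′ rewrite zb | zb′ =
    trans (*-congʳ (trans (*-congˡ (-‿inverseʳ (𝟙 x))) (zeroʳ t))) (zeroˡ _)

  decomposition-zeroBlock : ∀ n w → 1 ≤ n → zeroBlockᵇ w n ≡ true →
                            pow t (maxPathWeight n w) ≈ sum1 (n ∸ 1) (term n w) + 𝟙 (zeroBlockᵇ w n)
  decomposition-zeroBlock n w 1≤n zb rewrite maxPathWeight-zeroBlock n w zb | zb =
    sym (trans (+-congʳ (sum1-zero (n ∸ 1) (term n w) (λ i _ i≤ →
                  term-vanishes n w i true (zeroBlockᵇ-anti w n i (ℕ.<⇒≤ (i<n i≤)) zb) (zeroBlockᵇ-anti w n (suc i) (i<n i≤) zb))))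
               (+-identityˡ 1#))
    where
    i<n : ∀ {i} → i ≤ n ∸ 1 → i < n
    i<n i≤ = ℕ.≤-trans (s≤s i≤) (ℕ.≤-reflexive (ℕ.m+[n∸m]≡n 1≤n))

  decomposition-escape : ∀ n w k → Binary w → 1 ≤ k → k < n → zeroBlockᵇ w k ≡ true → zeroBlockᵇ w (suc k) ≡ false →
                         pow t (maxPathWeight n w) ≈ sum1 (n ∸ 1) (term n w) + 𝟙 (zeroBlockᵇ w n)
  decomposition-escape n w k bw 1≤k k<n zb zb′ = sym (begin
      sum1 (n ∸ 1) (term n w) + 𝟙 (zeroBlockᵇ w n)
    ≈⟨ +-cong (sum1-single (n ∸ 1) (term n w) k 1≤k (ℕ.∸-monoˡ-≤ 1 k<n) others)
              (reflexive (≡.cong 𝟙 (zeroBlockᵇ-false-mono w (suc k) n k<n zb′))) ⟩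
      term n w k + 0#
    ≈⟨ +-identityʳ _ ⟩
      t * (𝟙 (zeroBlockᵇ w k) - 𝟙 (zeroBlockᵇ w (suc k))) * pow t (maxPathWeight (n ∸ k) (shift k w))
    ≈⟨ *-congʳ (*-congˡ jump) ⟩
      t * 1# * pow t (maxPathWeight (n ∸ k) (shift k w))
    ≈⟨ *-congʳ (*-identityʳ t) ⟩
      pow t (suc (maxPathWeight (n ∸ k) (shift k w)))
    ≈⟨ reflexive (≡.cong (pow t) (≡.sym (maxPathWeight-escape k n w 1≤k k<n bw zb zb′))) ⟩
      pow t (maxPathWeight n w) ∎)
    where
    jump : 𝟙 (zeroBlockᵇ w k) - 𝟙 (zeroBlockᵇ w (suc k)) ≈ 1#
    jump rewrite zb | zb′ = trans (+-congˡ -0#≈0#) (+-identityʳ 1#)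
    others : ∀ i → 1 ≤ i → i ≤ n ∸ 1 → i ≢ k → term n w i ≈ 0#
    others i _ _ i≢k with ℕ.<-cmp i k
    ... | tri≈ _ i≡k _ = ⊥-elim (i≢k i≡k)
    ... | tri< i<k _ _ = term-vanishes n w i true (zeroBlockᵇ-anti w k i (ℕ.<⇒≤ i<k) zb) (zeroBlockᵇ-anti w k (suc i) i<k zb)
    ... | tri> _ _ k<i = term-vanishes n w i false (zeroBlockᵇ-false-mono w (suc k) i k<i zb′)
                                                   (zeroBlockᵇ-false-mono w (suc k) (suc i) (ℕ.≤-trans k<i (ℕ.n≤1+n i)) zb′)

  decomposition-from : ∀ n w → Binary w → ∀ d k → 1 ≤ k → k +ℕ d ≡ n → zeroBlockᵇ w k ≡ true →
                       pow t (maxPathWeight n w) ≈ sum1 (n ∸ 1) (term n w) + 𝟙 (zeroBlockᵇ w n)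
  decomposition-from n w bw zero k 1≤k refl zb rewrite ℕ.+-identityʳ k = decomposition-zeroBlock k w 1≤k zb
  decomposition-from n w bw (suc d) k 1≤k k+d≡n zb with zeroBlockᵇ w (suc k) in zb′
  ... | true = decomposition-from n w bw d (suc k) (s≤s z≤n) (≡.trans (≡.sym (ℕ.+-suc k d)) k+d≡n) zb′
  ... | false = decomposition-escape n w k bw 1≤k k<n zb zb′
    where
    k<n : k < n
    k<n = ℕ.≤-trans (s≤s (ℕ.m≤m+n k d)) (ℕ.≤-reflexive (≡.trans (≡.sym (ℕ.+-suc k d)) k+d≡n))

  decomposition : ∀ n → 1 ≤ n → ∀ w → Binary w →
                  pow t (maxPathWeight n w) ≈ sum1 (n ∸ 1) (term n w) + 𝟙 (zeroBlockᵇ w n)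
  decomposition n 1≤n w bw = decomposition-from n w bw (n ∸ 1) 1 ℕ.≤-refl (ℕ.m+[n∸m]≡n 1≤n) refl

  maxPathWeight-DependsOn : ∀ N → DependsOn (Inside N) (λ w → pow t (maxPathWeight N w))
  maxPathWeight-DependsOn N w w′ ag = reflexive (≡.cong (pow t) (maxPathWeight-local N w w′ ag))

  -- The zero-block indicators only see edges inside {1, …, i+1}, the shifted path weight only edges
  -- inside {i+1, …, n}; the two are independent.
  𝔼-term : ∀ n i → 1 ≤ i → i ≤ n ∸ 1 →
           𝔼 (edges n) (λ w → term n w i) ≈ t * (pow q (i C 2) - pow q (suc i C 2)) * EY p t (n ∸ i)
  𝔼-term n i 1≤i i≤ = trans (𝔼-independent S T S? disjoint (edges n) F G dF dG) (*-cong 𝔼F 𝔼G)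
    where
    i<n : i < n
    i<n = ℕ.≤-trans (s≤s i≤) (ℕ.≤-reflexive (ℕ.m+[n∸m]≡n (ℕ.≤-trans 1≤i (ℕ.≤-trans i≤ (ℕ.m∸n≤m n 1)))))
    F G : Weights → Carrier
    F w = t * (𝟙 (zeroBlockᵇ w i) - 𝟙 (zeroBlockᵇ w (suc i)))
    G w = pow t (maxPathWeight (n ∸ i) (shift i w))
    S T : ℕ → ℕ → Set
    S a b = b ≤ suc i
    T a b = suc i ≤ a × a < b × b ≤ n
    S? : Decidable S
    S? a b = b ℕ.≤? suc i
    disjoint : ∀ a b → S a b → T a b → ⊥
    disjoint a b b≤ (a≥ , a<b , _) = ℕ.<-irrefl refl (ℕ.≤-trans a<b (ℕ.≤-trans b≤ a≥))
    dF : DependsOn S F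
    dF w w′ ag = *-congˡ (+-cong (reflexive (≡.cong 𝟙 (zeroBlockᵇ-local w w′ i (λ a b b≤ → ag a b (ℕ.≤-trans b≤ (ℕ.n≤1+n i))))))
                                 (-‿cong (reflexive (≡.cong 𝟙 (zeroBlockᵇ-local w w′ (suc i) ag)))))
    dG : DependsOn T G
    dG w w′ ag = maxPathWeight-DependsOn (n ∸ i) (shift i w) (shift i w′) (λ a b (1≤a , a<b , b≤) →
      ag (i +ℕ a) (i +ℕ b) ( ℕ.≤-trans (ℕ.≤-reflexive (ℕ.+-comm 1 i)) (ℕ.+-monoʳ-≤ i 1≤a) , ℕ.+-monoʳ-< i a<b
                           , ℕ.≤-trans (ℕ.+-monoʳ-≤ i b≤) (ℕ.≤-reflexive (ℕ.m+[n∸m]≡n (ℕ.<⇒≤ i<n)))))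
    inside : ∀ k → k ≤ n → ∀ a b → Inside k a b → (a , b) ∈ edges n
    inside k k≤n a b (1≤a , a<b , b≤k) = ∈-edges⁺ n a b (1≤a , a<b , ℕ.≤-trans b≤k k≤n)
    𝔼F : 𝔼 (edges n) F ≈ t * (pow q (i C 2) - pow q (suc i C 2))
    𝔼F = trans (𝔼-*ˡ (edges n) t _)
         (*-congˡ (trans (𝔼-minus (edges n) _ _)
           (+-cong (𝔼-zeroBlock (edges n) i (inside i (ℕ.<⇒≤ i<n)))
                   (-‿cong (𝔼-zeroBlock (edges n) (suc i) (inside (suc i) i<n))))))
    𝔼G : 𝔼 (edges n) G ≈ EY p t (n ∸ i)
    𝔼G = trans (𝔼-restrict n i _ (ℕ.<⇒≤ i<n) (maxPathWeight-DependsOn (n ∸ i))) (sym (EY≈𝔼 (n ∸ i)))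

  recurrence : ∀ n → 1 ≤ n → Recurrence p t n
  recurrence n 1≤n = begin
      EY p t n
    ≈⟨ EY≈𝔼 n ⟩
      𝔼 (edges n) (λ w → pow t (maxPathWeight n w))
    ≈⟨ 𝔼-cong-Binary (edges n) _ _ (decomposition n 1≤n) ⟩
      𝔼 (edges n) (λ w → sum1 (n ∸ 1) (term n w) + 𝟙 (zeroBlockᵇ w n))
    ≈⟨ 𝔼-+ (edges n) _ _ ⟩
      𝔼 (edges n) (λ w → sum1 (n ∸ 1) (term n w)) + 𝔼 (edges n) (λ w → 𝟙 (zeroBlockᵇ w n))
    ≈⟨ +-cong (trans (𝔼-sum1 (edges n) (n ∸ 1) (λ i w → term n w i)) (sum1-cong (n ∸ 1) _ _ (𝔼-term n)))
              (𝔼-zeroBlock (edges n) n (∈-edges⁺ n)) ⟩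
      sum1 (n ∸ 1) (λ i → t * (pow q (i C 2) - pow q (suc i C 2)) * EY p t (n ∸ i)) + pow q (n C 2) ∎

module PowerSeries {c ℓ} (R : CommutativeRing c ℓ) where

  open CommutativeRing R renaming (refl to ≈-refl)
  open Model R
  open import Data.Nat using (zero; suc; _∸_; z≤n; s≤s) renaming (_+_ to _+ℕ_)
  import Data.Nat.Properties as ℕ
  open import Relation.Binary.PropositionalEquality as ≡ using (_≡_; refl)
  open import Relation.Binary.Reasoning.Setoid setoid
  open import Algebra.Properties.CommutativeSemigroup +-commutativeSemigroup using (interchange)
  open import Algebra.Properties.Group +-group using (∙-cancelʳ)

  sum0-cong : ∀ n f g → (∀ k → k ≤ n → f k ≈ g k) → sum0 n f ≈ sum0 n g
  sum0-cong zero f g h = h 0 z≤n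
  sum0-cong (suc n) f g h = +-cong (sum0-cong n f g (λ k k≤n → h k (ℕ.≤-trans k≤n (ℕ.n≤1+n n)))) (h (suc n) ℕ.≤-refl)

  sum0-≡ : ∀ {m n} f → m ≡ n → sum0 m f ≈ sum0 n f
  sum0-≡ f refl = ≈-refl

  sum0-+ : ∀ n f g → sum0 n (λ k → f k + g k) ≈ sum0 n f + sum0 n g
  sum0-+ zero f g = ≈-refl
  sum0-+ (suc n) f g = trans (+-congʳ (sum0-+ n f g)) (interchange _ _ _ _)

  sum0-*ˡ : ∀ n x f → sum0 n (λ k → x * f k) ≈ x * sum0 n f
  sum0-*ˡ zero x f = ≈-refl
  sum0-*ˡ (suc n) x f = trans (+-congʳ (sum0-*ˡ n x f)) (sym (distribˡ x _ _))

  sum0-*ʳ : ∀ n x f → sum0 n (λ k → f k * x) ≈ sum0 n f * x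
  sum0-*ʳ zero x f = ≈-refl
  sum0-*ʳ (suc n) x f = trans (+-congʳ (sum0-*ʳ n x f)) (sym (distribʳ x _ _))

  sum0-suc : ∀ n f → sum0 (suc n) f ≈ f 0 + sum0 n (λ k → f (suc k))
  sum0-suc zero f = ≈-refl
  sum0-suc (suc n) f = trans (+-congʳ (sum0-suc n f)) (+-assoc _ _ _)

  sum0-reverse : ∀ n f → sum0 n f ≈ sum0 n (λ k → f (n ∸ k))
  sum0-reverse zero f = ≈-refl
  sum0-reverse (suc n) f = sym (trans (sum0-suc n (λ k → f (suc n ∸ k)))
                                      (trans (+-congˡ (sym (sum0-reverse n f))) (+-comm _ _)))

  sum0≈sum1 : ∀ m f → sum0 m (λ k → f (suc k)) ≈ sum1 (suc m) f
  sum0≈sum1 zero f = sym (+-identityˡ _)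
  sum0≈sum1 (suc m) f = +-congʳ (sum0≈sum1 m f)

  sum0-triangle : ∀ n (a : ℕ → ℕ → Carrier) →
    sum0 n (λ m → sum0 m (λ i → a i m)) ≈ sum0 n (λ i → sum0 (n ∸ i) (λ j → a i (i +ℕ j)))
  sum0-triangle zero a = ≈-refl
  sum0-triangle (suc n) a = sym (begin
      sum0 n (λ i → sum0 (suc n ∸ i) (λ j → a i (i +ℕ j))) + sum0 (suc n ∸ suc n) (λ j → a (suc n) (suc n +ℕ j))
    ≈⟨ +-cong (sum0-cong n _ _ row) (trans (sum0-≡ (λ j → a (suc n) (suc n +ℕ j)) (ℕ.n∸n≡0 n))
                                         (reflexive (≡.cong (a (suc n)) (ℕ.+-identityʳ (suc n))))) ⟩
      sum0 n (λ i → sum0 (n ∸ i) (λ j → a i (i +ℕ j)) + a i (suc n)) + a (suc n) (suc n)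
    ≈⟨ +-congʳ (sum0-+ n _ _) ⟩
      (sum0 n (λ i → sum0 (n ∸ i) (λ j → a i (i +ℕ j))) + sum0 n (λ i → a i (suc n))) + a (suc n) (suc n)
    ≈⟨ +-assoc _ _ _ ⟩
      sum0 n (λ i → sum0 (n ∸ i) (λ j → a i (i +ℕ j))) + sum0 (suc n) (λ i → a i (suc n))
    ≈⟨ +-congʳ (sym (sum0-triangle n a)) ⟩
      sum0 (suc n) (λ m → sum0 m (λ i → a i m)) ∎)
    where
    row : ∀ i → i ≤ n → sum0 (suc n ∸ i) (λ j → a i (i +ℕ j)) ≈ sum0 (n ∸ i) (λ j → a i (i +ℕ j)) + a i (suc n)
    row i i≤n = trans (sum0-≡ (λ j → a i (i +ℕ j)) (ℕ.+-∸-assoc 1 i≤n))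
                      (+-congˡ (reflexive (≡.cong (a i) (≡.trans (ℕ.+-suc i (n ∸ i)) (≡.cong suc (ℕ.m+[n∸m]≡n i≤n))))))

  ·-comm : ∀ f g n → (f · g) n ≈ (g · f) n
  ·-comm f g n = trans (sum0-reverse n _) (sum0-cong n _ _ (λ k k≤n →
    trans (*-comm _ _) (reflexive (≡.cong (λ z → g z * f (n ∸ k)) (ℕ.m∸[m∸n]≡n k≤n)))))

  ·-congˡ : ∀ f g g′ → (∀ n → g n ≈ g′ n) → ∀ n → (f · g) n ≈ (f · g′) n
  ·-congˡ f g g′ h n = sum0-cong n _ _ (λ k _ → *-congˡ (h (n ∸ k)))

  ·-congʳ : ∀ f f′ g → (∀ n → f n ≈ f′ n) → ∀ n → (f · g) n ≈ (f′ · g) n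
  ·-congʳ f f′ g h n = sum0-cong n _ _ (λ k _ → *-congʳ (h k))

  ·-distribˡ-+ : ∀ f g h n → (f · (λ m → g m + h m)) n ≈ (f · g) n + (f · h) n
  ·-distribˡ-+ f g h n = trans (sum0-cong n _ _ (λ k _ → distribˡ (f k) _ _)) (sum0-+ n _ _)

  ·-identityʳ : ∀ f n → (f · oneS) n ≈ f n
  ·-identityʳ f zero = *-identityʳ (f 0)
  ·-identityʳ f (suc n) =
    trans (+-cong (trans (sum0-cong n _ (λ _ → 0#) (λ k k≤n →
                     trans (*-congˡ (reflexive (≡.cong oneS (ℕ.+-∸-assoc 1 k≤n)))) (zeroʳ _)))
                   (zeros n))
                  (trans (*-congˡ (reflexive (≡.cong oneS (ℕ.n∸n≡0 (suc n))))) (*-identityʳ _)))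
          (+-identityˡ _)
    where
    zeros : ∀ m → sum0 m (λ _ → 0#) ≈ 0#
    zeros zero = ≈-refl
    zeros (suc m) = trans (+-identityʳ _) (zeros m)

  ·-assoc : ∀ f g h n → ((f · g) · h) n ≈ (f · (g · h)) n
  ·-assoc f g h n =
    trans (sum0-cong n _ _ (λ m _ → sym (sum0-*ʳ m (h (n ∸ m)) _)))
    (trans (sum0-triangle n (λ i m → f i * g (m ∸ i) * h (n ∸ m)))
    (sum0-cong n _ _ (λ i _ → trans (sum0-cong (n ∸ i) _ _ (λ j _ →
        trans (*-assoc _ _ _) (*-congˡ (reflexive (≡.cong₂ (λ u v → g u * h v) (ℕ.m+n∸m≡n i j) (≡.sym (ℕ.∸-+-assoc n i j)))))))
      (sum0-*ˡ (n ∸ i) (f i) _))))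

  -- A series with constant term 1 can be cancelled: the coefficients of U are determined one by one.
  ·-cancelˡ : ∀ (D U V : Series) → D 0 ≈ 1# → (∀ n → (D · U) n ≈ (D · V) n) → ∀ n → U n ≈ V n
  ·-cancelˡ D U V D0≈1 DU≈DV n = upTo n n ℕ.≤-refl
    where
    D0* : ∀ x → D 0 * x ≈ x
    D0* x = trans (*-congʳ D0≈1) (*-identityˡ x)
    upTo : ∀ n m → m ≤ n → U m ≈ V m
    upTo n zero _ = trans (sym (D0* (U 0))) (trans (DU≈DV 0) (D0* (V 0)))
    upTo (suc n) (suc m) (s≤s m≤n) =
      trans (sym (D0* _)) (trans (∙-cancelʳ _ _ _
        (trans (sym (sum0-suc m (λ k → D k * U (suc m ∸ k))))
        (trans (DU≈DV (suc m))
        (trans (sum0-suc m (λ k → D k * V (suc m ∸ k)))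
               (+-congˡ (sum0-cong m _ _ (λ k k≤m → *-congˡ (sym (upTo n (m ∸ k) (ℕ.≤-trans (ℕ.m∸n≤m m k) m≤n)))))))))) (D0* _))

module GeneratingFunction {c ℓ} (R : CommutativeRing c ℓ) (p t : CommutativeRing.Carrier R) where

  open CommutativeRing R renaming (refl to ≈-refl)
  open Model R
  open PowerSeries R
  open Sums R using (sum1-cong)
  open Recurrence R p t using (recurrence)
  open import Data.Nat using (zero; suc; _∸_; z≤n; s≤s)
  import Data.Nat.Properties as ℕ
  open import Relation.Binary.PropositionalEquality as ≡ using (_≡_; refl)
  open import Relation.Binary.Reasoning.Setoid setoid
  open import Algebra.Properties.Ring ring using (-0#≈0#; -‿distribˡ-*)
  open import Algebra.Properties.AbelianGroup +-abelianGroup using (⁻¹-∙-comm)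

  sum1-neg : ∀ m f → sum1 m (λ i → - f i) ≈ - sum1 m f
  sum1-neg zero f = sym -0#≈0#
  sum1-neg (suc m) f = trans (+-congʳ (sum1-neg m f)) (⁻¹-∙-comm _ _)

  [s+a]-[s+x]≈a-x : ∀ s a x → (s + a) - (s + x) ≈ a - x
  [s+a]-[s+x]≈a-x s a x = begin
    (s + a) + - (s + x)     ≈⟨ +-congˡ (sym (⁻¹-∙-comm s x)) ⟩
    (s + a) + (- s + - x)   ≈⟨ interchange s a (- s) (- x) ⟩
    (s + - s) + (a + - x)   ≈⟨ +-congʳ (-‿inverseʳ s) ⟩
    0# + (a + - x)          ≈⟨ +-identityˡ _ ⟩
    a + - x                 ∎
    where open import Algebra.Properties.CommutativeSemigroup +-commutativeSemigroup using (interchange)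

  coeff : ℕ → Carrier
  coeff i = t * (A p i - B p i)

  Den-0 : Den p t 0 ≈ 1#
  Den-0 = trans (+-congˡ (trans (-‿cong (trans (*-congˡ (-‿inverseʳ 1#)) (zeroʳ t))) -0#≈0#)) (+-identityʳ 1#)

  Den-suc : ∀ i → Den p t (suc i) ≈ - coeff (suc i)
  Den-suc i = +-identityˡ _

  Z-suc∸ : ∀ m i → i ≤ m → Z p t (suc m ∸ i) ≡ EY p t (suc m ∸ i)
  Z-suc∸ m i i≤m = ≡.trans (≡.cong (Z p t) (ℕ.+-∸-assoc 1 i≤m)) (≡.cong (EY p t) (≡.sym (ℕ.+-∸-assoc 1 i≤m)))

  -- This is the recurrence, multiplied out as an identity of series.
  Den·Z : ∀ n → (Den p t · Z p t) n ≈ Den p t n + xTimes (B p) n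
  Den·Z zero = trans (*-identityʳ _) (sym (+-identityʳ _))
  Den·Z (suc m) = begin
      (Den p t · Z p t) (suc m)
    ≈⟨ sum0-suc m (λ k → Den p t k * Z p t (suc m ∸ k)) ⟩
      Den p t 0 * EY p t (suc m) + sum0 m (λ k → Den p t (suc k) * Z p t (m ∸ k))
    ≈⟨ +-cong (trans (*-congʳ Den-0) (*-identityˡ _)) (sum0≈sum1 m (λ i → Den p t i * Z p t (suc m ∸ i))) ⟩
      EY p t (suc m) + sum1 (suc m) (λ i → Den p t i * Z p t (suc m ∸ i))
    ≈⟨ +-cong (recurrence (suc m) (s≤s z≤n)) (trans (sum1-cong (suc m) _ (λ i → - (coeff i * Z p t (suc m ∸ i))) negated)
                                                    (sum1-neg (suc m) _)) ⟩
      (S + B p m) + - (sum1 m (λ i → coeff i * Z p t (suc m ∸ i)) + coeff (suc m) * Z p t (m ∸ m))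
    ≈⟨ +-congˡ (-‿cong (+-cong (sum1-cong m _ _ (λ i _ i≤m → *-congˡ (reflexive (Z-suc∸ m i i≤m))))
                               (trans (*-congˡ (reflexive (≡.cong (Z p t) (ℕ.n∸n≡0 m)))) (*-identityʳ _)))) ⟩
      (S + B p m) - (S + coeff (suc m))
    ≈⟨ [s+a]-[s+x]≈a-x S (B p m) (coeff (suc m)) ⟩
      B p m - coeff (suc m)
    ≈⟨ trans (+-comm _ _) (+-congʳ (sym (Den-suc m))) ⟩
      Den p t (suc m) + B p m ∎
    where
    S : Carrier
    S = sum1 m (λ i → coeff i * EY p t (suc m ∸ i))
    negated : ∀ i → 1 ≤ i → i ≤ suc m → Den p t i * Z p t (suc m ∸ i) ≈ - (coeff i * Z p t (suc m ∸ i))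
    negated (suc i) _ _ = trans (*-congʳ (Den-suc i)) (sym (-‿distribˡ-* _ _))

  Den·[1+xB·G] : ∀ G → (∀ n → (Den p t · G) n ≈ oneS n) →
                 ∀ n → (Den p t · (λ m → oneS m + (xTimes (B p) · G) m)) n ≈ Den p t n + xTimes (B p) n
  Den·[1+xB·G] G DG≈1 n = begin
      (D · (λ m → oneS m + (xB · G) m)) n
    ≈⟨ ·-distribˡ-+ D oneS (xB · G) n ⟩
      (D · oneS) n + (D · (xB · G)) n
    ≈⟨ +-congˡ (sym (·-assoc D xB G n)) ⟩
      (D · oneS) n + ((D · xB) · G) n
    ≈⟨ +-cong (·-identityʳ D n) (·-congʳ (D · xB) (xB · D) G (·-comm D xB) n) ⟩
      D n + ((xB · D) · G) n
    ≈⟨ +-congˡ (·-assoc xB D G n) ⟩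
      D n + (xB · (D · G)) n
    ≈⟨ +-congˡ (trans (·-congˡ xB (D · G) oneS DG≈1 n) (·-identityʳ xB n)) ⟩
      D n + xB n ∎
    where
    D xB : Series
    D = Den p t
    xB = xTimes (B p)

  generatingFunction : GFIdentity p t
  generatingFunction G DG≈1 =
    ·-cancelˡ (Den p t) (Z p t) _ Den-0 (λ n → trans (Den·Z n) (sym (Den·[1+xB·G] G DG≈1 n)))

theorem2 : ∀ {c ℓ} (R : CommutativeRing c ℓ) (p t : CommutativeRing.Carrier R) →
           ((n : ℕ) → 1 ≤ n → Model.Recurrence R p t n) × Model.GFIdentity R p t
theorem2 R p t = Recurrence.recurrence R p t , GeneratingFunction.generatingFunction R p t
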